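{- Let $G$ be a non-bipartite undirected graph. Then no stubborn edge of $G$ appears exactly once in a closed walk of even length in $G$.
   Context: A walk is a sequence of vertices with consecutive vertices adjacent (vertices and edges may repeat); its length is its number of edges; it is closed if it starts and ends at the same vertex. An edge is stubborn if it belongs to every closed walk of odd length in $G$. -}

module Defs where

open import Data.Nat using (ℕ; zero; suc; _+_)
open import Data.Fin using (Fin; zero; suc; inject₁; fromℕ)
open import Data.Bool using (Bool)
open import Data.Product using (Σ; ∃; ∃-syntax; _×_; _,_)
open import Data.Sum using (_⊎_)
open import Relation.Binary.PropositionalEquality using (_≡_; _≢_)
open import Relation.Nullary using (¬_)

record Graph (n : ℕ) : Set₁ where
  field
    Adj   : Fin n → Fin n → Set
    sym   : ∀ {u v} → Adj u v → Adj v u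
    irrefl : ∀ {u} → ¬ Adj u u
open Graph public

Even : ℕ → Set
Even k = ∃[ m ] k ≡ m + m

Odd : ℕ → Set
Odd k = ∃[ m ] k ≡ suc (m + m)

Bipartite : ∀ {n} → Graph n → Set
Bipartite {n} G = Σ (Fin n → Bool) λ c → (∀ (u v : Fin n) → Adj G u v → c u ≢ c v)

-- A walk of length k (k edges): a sequence of k+1 vertices w 0, …, w k,
-- consecutive vertices adjacent.
IsWalk : ∀ {n} → Graph n → (k : ℕ) → (Fin (suc k) → Fin n) → Set
IsWalk G k w = ∀ (i : Fin k) → Adj G (w (inject₁ i)) (w (suc i))

IsClosed : ∀ {n} (k : ℕ) → (Fin (suc k) → Fin n) → Set
IsClosed k w = w zero ≡ w (fromℕ k)

StepUses : ∀ {n} {k : ℕ} → (Fin (suc k) → Fin n) → Fin k → Fin n → Fin n → Set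
StepUses w i u v =
  (w (inject₁ i) ≡ u × w (suc i) ≡ v) ⊎ (w (inject₁ i) ≡ v × w (suc i) ≡ u)

EdgeIn : ∀ {n} {k : ℕ} → (Fin (suc k) → Fin n) → Fin n → Fin n → Set
EdgeIn {k = k} w u v = ∃[ i ] StepUses {k = k} w i u v

EdgeExactlyOnce : ∀ {n} {k : ℕ} → (Fin (suc k) → Fin n) → Fin n → Fin n → Set
EdgeExactlyOnce {k = k} w u v =
  ∃[ i ] (StepUses {k = k} w i u v × (∀ j → StepUses {k = k} w j u v → j ≡ i))

Stubborn : ∀ {n} → Graph n → Fin n → Fin n → Set
Stubborn G u v =
  Adj G u v ×
  (∀ (k : ℕ) (w : Fin (suc k) → _) → IsWalk G k w → IsClosed k w → Odd k → EdgeIn w u v)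

-- Deleting the stubborn edge {u,v} leaves a graph with no closed walk of odd
-- length, hence (classically) a bipartite one.  If {u,v} were used exactly once
-- by a closed walk of even length, the rest of that walk would be a walk of odd
-- length from v to u avoiding {u,v}, so u and v get different colours, and the
-- colouring would also be proper for G.  Since the conclusion is negative, the
-- reachability decisions needed to build the colouring may be taken by excluded
-- middle, finitely often.
module Submission where

open import Defs hiding (sym)
open import Data.Bool using (Bool; true; false; not; _xor_)
open import Data.Bool.Properties
  using (not-distribˡ-xor; not-distribʳ-xor; not-involutive; xor-comm; not-¬; ¬-not)
open import Data.Fin using (Fin; zero; suc; inject₁; fromℕ; _≤_; _≟_)
open import Data.Fin.Properties using (≤-antisym; suc-injective)
open import Data.Nat using (ℕ; zero; suc; _+_; z≤n; s≤s)
open import Data.Nat.Properties using (+-suc)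
open import Data.Product using (Σ; ∃; ∃-syntax; _×_; _,_; proj₁; proj₂)
open import Data.Sum using (_⊎_; inj₁; inj₂)
open import Data.Vec.Functional using (_∷_; tail)
open import Function using (_∘_)
open import Relation.Nullary using (¬_; Dec; yes; no; does; contradiction)
open import Relation.Nullary.Decidable using (_×-dec_; _⊎-dec_; ¬¬-excluded-middle)
open import Relation.Binary.PropositionalEquality
  using (_≡_; refl; sym; trans; cong; subst; _≢_; module ≡-Reasoning)

odd : ℕ → Bool
odd zero    = false
odd (suc k) = not (odd k)

odd≡true⇒Odd   : ∀ k → odd k ≡ true → Odd k
odd≡false⇒Even : ∀ k → odd k ≡ false → Even k
odd≡true⇒Odd (suc k) _ with odd k in ok
... | false with odd≡false⇒Even k ok
...   | m , refl = m , refl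
odd≡false⇒Even zero    _ = 0 , refl
odd≡false⇒Even (suc k) _ with odd k in ok
... | true with odd≡true⇒Odd k ok
...   | m , refl = suc m , cong suc (sym (+-suc m m))

Even⇒odd≡false : ∀ {k} → Even k → odd k ≡ false
Even⇒odd≡false (m , refl) = odd-m+m m
  where
  odd-m+m : ∀ m → odd (m + m) ≡ false
  odd-m+m zero = refl
  odd-m+m (suc m) rewrite +-suc m m = cong (not ∘ not) (odd-m+m m)

¬¬-∀ : ∀ {n p} {P : Fin n → Set p} → (∀ i → ¬ ¬ P i) → ¬ ¬ (∀ i → P i)
¬¬-∀ {zero}  h ¬∀ = ¬∀ λ ()
¬¬-∀ {suc n} h ¬∀ =
  h zero λ P₀ → ¬¬-∀ (h ∘ suc) λ P₊ → ¬∀ λ { zero → P₀ ; (suc i) → P₊ i }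

¬¬-decidable₂ : ∀ {n p} (P : Fin n → Fin n → Set p) → ¬ ¬ (∀ x y → Dec (P x y))
¬¬-decidable₂ P = ¬¬-∀ λ x → ¬¬-∀ λ y → ¬¬-excluded-middle

least : ∀ {n p} {P : Fin n → Set p} → (∀ i → Dec (P i)) →
        ∀ {i} → P i → ∃[ m ] P m × (∀ {j} → P j → m ≤ j)
least {suc n} P? {i} Pi with P? zero
... | yes P₀ = zero , P₀ , λ _ → z≤n
least {suc n} P? {zero}  P₀ | no ¬P₀ = contradiction P₀ ¬P₀
least {suc n} {P = P} P? {suc i} Pi | no ¬P₀ with least (P? ∘ suc) Pi
... | m , Pm , m-least = suc m , Pm , above
  where
  above : ∀ {j} → P j → suc m ≤ j
  above {zero}  P₀ = contradiction P₀ ¬P₀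
  above {suc j} Pj = s≤s (m-least Pj)

module ParityWalk {A : Set} (R : A → A → Set) where

  infixr 5 _◅_ _◅◅_

  data Walk : A → A → Bool → Set where
    ε   : ∀ {x} → Walk x x false
    _◅_ : ∀ {x y z b} → R x y → Walk y z b → Walk x z (not b)

  _◅◅_ : ∀ {x y z a b} → Walk x y a → Walk y z b → Walk x z (a xor b)
  ε ◅◅ q = q
  _◅◅_ {b = b} (_◅_ {b = a} r p) q =
    subst (Walk _ _) (not-distribˡ-xor a b) (r ◅ p ◅◅ q)

  Reachable : A → A → Set
  Reachable x y = ∃ (Walk x y)

  Steps : ∀ k → (Fin (suc k) → A) → Set
  Steps k w = ∀ i → R (w (inject₁ i)) (w (suc i))

  Steps⇒Walk : ∀ k (w : Fin (suc k) → A) → Steps k w → Walk (w zero) (w (fromℕ k)) (odd k)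
  Steps⇒Walk zero    w steps = ε
  Steps⇒Walk (suc k) w steps = steps zero ◅ Steps⇒Walk k (tail w) (steps ∘ suc)

  Walk⇒Steps : ∀ {x y b} → Walk x y b →
    ∃[ k ] Σ (Fin (suc k) → A) λ w →
      Steps k w × w zero ≡ x × w (fromℕ k) ≡ y × odd k ≡ b
  Walk⇒Steps {x} ε = 0 , (λ _ → x) , (λ ()) , refl , refl , refl
  Walk⇒Steps {x} (r ◅ p) with Walk⇒Steps p
  ... | k , w , steps , refl , end , parity =
    suc k , x ∷ w , (λ { zero → r ; (suc i) → steps i }) , refl , end , cong not parity

  split-at : ∀ k (w : Fin (suc k) → A) (i : Fin k) →
    (∀ j → j ≢ i → R (w (inject₁ j)) (w (suc j))) →
    ∃[ a ] ∃[ b ] Walk (w zero) (w (inject₁ i)) a × Walk (w (suc i)) (w (fromℕ k)) b ×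
                  a xor b ≡ not (odd k)
  split-at (suc k) w zero    steps =
    false , odd k , ε , Steps⇒Walk k (tail w) (λ j → steps (suc j) λ ()) ,
    sym (not-involutive (odd k))
  split-at (suc k) w (suc i) steps
    with split-at k (tail w) i (λ j j≢i → steps (suc j) (j≢i ∘ suc-injective))
  ... | a , b , p , q , parity =
    not a , b , steps zero (λ ()) ◅ p , q , trans (sym (not-distribˡ-xor a b)) (cong not parity)

  closed-walk-without-step : ∀ k (w : Fin (suc k) → A) (i : Fin k) → w zero ≡ w (fromℕ k) →
    (∀ j → j ≢ i → R (w (inject₁ j)) (w (suc j))) →
    Walk (w (suc i)) (w (inject₁ i)) (not (odd k))
  closed-walk-without-step k w i closed steps with split-at k w i steps
  ... | a , b , p , q , parity =
    subst (Walk _ _) (trans (xor-comm b a) parity)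
      (q ◅◅ subst (λ x → Walk x (w (inject₁ i)) a) closed p)

  ProperColouring : (A → Bool) → Set
  ProperColouring c = ∀ x y → R x y → c x ≢ c y

  colour-along : ∀ {c} → ProperColouring c → ∀ {x y b} → Walk x y b → c y ≡ b xor c x
  colour-along proper ε = refl
  colour-along {c} proper {x} {z} (_◅_ {y = y} {b = b} r p) = begin
    c z               ≡⟨ colour-along proper p ⟩
    b xor c y         ≡⟨ cong (b xor_) (¬-not (proper x y r ∘ sym)) ⟩
    b xor not (c x)   ≡⟨ sym (not-distribʳ-xor b (c x)) ⟩
    not (b xor c x)   ≡⟨ not-distribˡ-xor b (c x) ⟩
    not b xor c x     ∎
    where open ≡-Reasoning

  odd-walk⇒colours-differ : ∀ {c} → ProperColouring c → ∀ {x y} → Walk x y true → c x ≢ c y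
  odd-walk⇒colours-differ proper p c≡ = not-¬ refl (trans c≡ (colour-along proper p))

  module _ (R-sym : ∀ {x y} → R x y → R y x) where

    reverse : ∀ {x y b} → Walk x y b → Walk y x b
    reverse ε = ε
    reverse (_◅_ {b = b} r p) = subst (Walk _ _) (xor-comm b true) (reverse p ◅◅ R-sym r ◅ ε)

module Bipartition {n} (R : Fin n → Fin n → Set) (R-sym : ∀ {x y} → R x y → R y x) where
  open ParityWalk R

  NoOddClosedWalk : Set
  NoOddClosedWalk = ∀ x → ¬ Walk x x true

  module Colouring (no-odd : NoOddClosedWalk)
                   (reachable? : ∀ x y → Dec (Reachable x y))
                   (even? : ∀ x y → Dec (Walk x y false)) where

    step-reachable : ∀ {x x' y} → R x x' → Reachable x' y → Reachable x y
    step-reachable r (b , p) = not b , r ◅ p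

    least-reachable : ∀ x → ∃[ m ] Reachable x m × (∀ {y} → Reachable x y → m ≤ y)
    least-reachable x = least (reachable? x) (false , ε)

    root : Fin n → Fin n
    root = proj₁ ∘ least-reachable

    root-cong : ∀ {x x'} → R x x' → root x ≡ root x'
    root-cong {x} {x'} r with least-reachable x | least-reachable x'
    ... | m , x↝m , m-least | m' , x'↝m' , m'-least =
      ≤-antisym (m-least (step-reachable r x'↝m')) (m'-least (step-reachable (R-sym r) x↝m))

    colour : Fin n → Bool
    colour x = does (even? x (root x))

    even-flips : ∀ {x x' m} → R x x' → Reachable x' m → does (even? x m) ≢ does (even? x' m)
    even-flips {x} {x'} {m} r x'↝m with even? x m | even? x' m | x'↝m
    ... | yes p | yes p' | _          = λ _ → no-odd x (r ◅ p' ◅◅ reverse R-sym p)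
    ... | no ¬p | no ¬p' | false , q = λ _ → ¬p' q
    ... | no ¬p | no ¬p' | true  , q = λ _ → ¬p (r ◅ q)
    ... | yes _ | no _   | _          = λ ()
    ... | no _  | yes _  | _          = λ ()

    colour-proper : ProperColouring colour
    colour-proper x x' r same =
      even-flips r (proj₁ (proj₂ (least-reachable x')))
        (subst (λ m → does (even? x m) ≡ colour x') (root-cong r) same)

    bipartition : Σ (Fin n → Bool) ProperColouring
    bipartition = colour , colour-proper

  no-odd-closed-walk⇒bipartite : NoOddClosedWalk → ¬ ¬ Σ (Fin n → Bool) ProperColouring
  no-odd-closed-walk⇒bipartite no-odd ¬bipartite =
    ¬¬-decidable₂ Reachable λ reachable? →
    ¬¬-decidable₂ (λ x y → Walk x y false) λ even? →
    ¬bipartite (Colouring.bipartition no-odd reachable? even?)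

SameEdge : ∀ {n} → Fin n → Fin n → Fin n → Fin n → Set
SameEdge a b u v = (a ≡ u × b ≡ v) ⊎ (a ≡ v × b ≡ u)

SameEdge-swap : ∀ {n} {a b u v : Fin n} → SameEdge a b u v → SameEdge b a u v
SameEdge-swap (inj₁ (a≡u , b≡v)) = inj₂ (b≡v , a≡u)
SameEdge-swap (inj₂ (a≡v , b≡u)) = inj₁ (b≡u , a≡v)

sameEdge? : ∀ {n} (a b u v : Fin n) → Dec (SameEdge a b u v)
sameEdge? a b u v = (a ≟ u ×-dec b ≟ v) ⊎-dec (a ≟ v ×-dec b ≟ u)

module EdgeDeletion {n} (G : Graph n) (u v : Fin n) where

  AdjWithout : Fin n → Fin n → Set
  AdjWithout a b = Adj G a b × ¬ SameEdge a b u v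

  AdjWithout-sym : ∀ {a b} → AdjWithout a b → AdjWithout b a
  AdjWithout-sym (ab , ¬uv) = Graph.sym G ab , ¬uv ∘ SameEdge-swap

  open ParityWalk AdjWithout public
  open Bipartition AdjWithout AdjWithout-sym public

  stubborn⇒no-odd-closed-walk : Stubborn G u v → NoOddClosedWalk
  stubborn⇒no-odd-closed-walk (_ , stubborn) x p with Walk⇒Steps p
  ... | k , w , steps , start , end , parity
    with stubborn k w (proj₁ ∘ steps) (trans start (sym end)) (odd≡true⇒Odd k parity)
  ...   | i , uses = proj₂ (steps i) uses

  orient : ∀ {a b} → SameEdge a b u v → Walk b a true → Walk u v true
  orient (inj₁ (refl , refl)) p = reverse AdjWithout-sym p
  orient (inj₂ (refl , refl)) p = p

  odd-walk-avoiding-edge : ∀ k (w : Fin (suc k) → Fin n) →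
    IsWalk G k w → IsClosed k w → Even k → EdgeExactlyOnce w u v → Walk u v true
  odd-walk-avoiding-edge k w walk closed even (i , uses , only) =
    orient uses (subst (Walk _ _) (cong not (Even⇒odd≡false even))
                       (closed-walk-without-step k w i closed avoids))
    where
    avoids : ∀ j → j ≢ i → AdjWithout (w (inject₁ j)) (w (suc j))
    avoids j j≢i = walk j , j≢i ∘ only j

  add-edge : ∀ {c} → ProperColouring c → c u ≢ c v → ∀ a b → Adj G a b → c a ≢ c b
  add-edge {c} proper cu≢cv a b ab with sameEdge? a b u v
  ... | no ¬uv = proper a b (ab , ¬uv)
  ... | yes (inj₁ (refl , refl)) = cu≢cv
  ... | yes (inj₂ (refl , refl)) = cu≢cv ∘ sym

proposition1 : ∀ {n} (G : Graph n) → ¬ Bipartite G →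
    ∀ (u v : Fin n) → Stubborn G u v →
    ∀ (k : ℕ) (w : Fin (suc k) → Fin n) → IsWalk G k w → IsClosed k w → Even k →
    ¬ EdgeExactlyOnce w u v
proposition1 G ¬bipartite u v stubborn k w walk closed even once =
  no-odd-closed-walk⇒bipartite (stubborn⇒no-odd-closed-walk stubborn) λ (c , proper) →
    let odd-u-v = odd-walk-avoiding-edge k w walk closed even once
    in ¬bipartite (c , add-edge proper (odd-walk⇒colours-differ proper odd-u-v))
  where open EdgeDeletion G u v
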